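{- Let $M$ be a maximal planar graph or an $n$-semi-MPG with $n\ge 4$. If either $M$ has no R-tiling, or every R-tiling of $M$ has at least one red odd-cycle, then $M$ is not 4-colorable.
   Context: A maximal planar graph (MPG) is a simple plane graph all of whose faces, including the outer one, are triangles. An $n$-semi-MPG is a connected simple plane graph in which every face is a triangle except one designated face, the outer facet, which is an $n$-gon. An R-tiling of $M$ is a map $T_r:E(M)\to\{\text{red},\text{black}\}$ such that every triangular face (other than the outer facet) has exactly one red edge. A red odd-cycle is a cycle of odd length all of whose edges are red. -}

module Defs where

open import Data.Nat using (ℕ; zero; suc; _+_; _≤_; _<_)
open import Data.Fin using (Fin)
open import Data.Bool using (Bool; true; false)
open import Data.Product using (Σ; ∃; _×_; _,_)
open import Data.Sum using (_⊎_)
open import Data.Unit using (⊤)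
open import Data.Empty using (⊥)
open import Function using (_∘_)
open import Relation.Nullary using (¬_)
open import Relation.Binary.PropositionalEquality using (_≡_; _≢_)

-- Plane graphs are represented combinatorially by rotation systems
-- (combinatorial maps): a set of darts (half-edges), a fixed-point-free
-- involution α pairing the two darts of each edge, and a permutation σ
-- (the rotation) whose orbits are the vertices.  Faces are the orbits of
-- φ = σ ∘ α.  A connected map is planar (genus 0) iff V - E + F = 2.

iter : {A : Set} → (A → A) → ℕ → A → A
iter f zero    x = x
iter f (suc k) x = f (iter f k x)

data Reach {D : ℕ} (α σ : Fin D → Fin D) : Fin D → Fin D → Set where
  here  : ∀ {d} → Reach α σ d d
  stepα : ∀ {d e} → Reach α σ d e → Reach α σ d (α e)
  stepσ : ∀ {d e} → Reach α σ d e → Reach α σ d (σ e)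

OrbitSize : {A : Set} → (A → A) → A → ℕ → Set
OrbitSize f x n = (0 < n) × (iter f n x ≡ x) × (∀ k → 0 < k → k < n → iter f k x ≢ x)

record PlaneGraph : Set where
  field
    E V F : ℕ
    α     : Fin (E + E) → Fin (E + E)
    α-inv : ∀ d → α (α d) ≡ d
    α-fpf : ∀ d → α d ≢ d
    σ     : Fin (E + E) → Fin (E + E)
    σ⁻¹   : Fin (E + E) → Fin (E + E)
    σσ⁻¹  : ∀ d → σ (σ⁻¹ d) ≡ d
    σ⁻¹σ  : ∀ d → σ⁻¹ (σ d) ≡ d
    vert       : Fin (E + E) → Fin V
    vert-surj  : ∀ v → ∃ λ d → vert d ≡ v
    vert-orbit : ∀ d d' → vert d ≡ vert d' → ∃ λ k → iter σ k d ≡ d'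
    orbit-vert : ∀ d k → vert (iter σ k d) ≡ vert d
    face       : Fin (E + E) → Fin F
    face-surj  : ∀ f → ∃ λ d → face d ≡ f
    face-orbit : ∀ d d' → face d ≡ face d' → ∃ λ k → iter (σ ∘ α) k d ≡ d'
    orbit-face : ∀ d k → face (iter (σ ∘ α) k d) ≡ face d
    connected  : ∀ d d' → Reach α σ d d'
    euler      : V + F ≡ E + 2
    no-loop    : ∀ d → vert (α d) ≢ vert d
    no-multi   : ∀ d d' → vert d ≡ vert d' → vert (α d) ≡ vert (α d') → d ≡ d'

module _ (M : PlaneGraph) where
  open PlaneGraph M

  Dart : Set
  Dart = Fin (E + E)

  φ : Dart → Dart
  φ = σ ∘ α

  Adj : Fin V → Fin V → Set
  Adj u v = ∃ λ d → vert d ≡ u × vert (α d) ≡ v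

  TriangularAt : Dart → Set
  TriangularAt d = OrbitSize φ d 3

  NGonAt : ℕ → Dart → Set
  NGonAt n d = OrbitSize φ d n
             × (∀ i j → i < n → j < n → vert (iter φ i d) ≡ vert (iter φ j d) → i ≡ j)

  IsMPG : Set
  IsMPG = ∀ d → TriangularAt d

  IsSemiMPG : ℕ → Fin F → Set
  IsSemiMPG n o = ∀ d → (face d ≡ o → NGonAt n d) × (face d ≢ o → TriangularAt d)

data Kind (M : PlaneGraph) : Set where
  mpg  : IsMPG M → Kind M
  semi : (n : ℕ) → 4 ≤ n → (o : Fin (PlaneGraph.F M)) → IsSemiMPG M n o → Kind M

module _ {M : PlaneGraph} where
  open PlaneGraph M

  Inner : Kind M → Fin F → Set
  Inner (mpg _)          f = ⊤
  Inner (semi _ _ o _)   f = f ≢ o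

-- true = red, false = black
ExactlyOneTrue : Bool → Bool → Bool → Set
ExactlyOneTrue true  false false = ⊤
ExactlyOneTrue false true  false = ⊤
ExactlyOneTrue false false true  = ⊤
ExactlyOneTrue _     _     _     = ⊥

module _ (M : PlaneGraph) where
  open PlaneGraph M

  EdgeColouring : Set
  EdgeColouring = Σ (Dart M → Bool) λ T → ∀ d → T (α d) ≡ T d

  IsRTiling : Kind M → EdgeColouring → Set
  IsRTiling K (T , _) =
    ∀ d → Inner K (face d) → ExactlyOneTrue (T d) (T (φ M d)) (T (φ M (φ M d)))

  RedAdj : EdgeColouring → Fin V → Fin V → Set
  RedAdj (T , _) u v = ∃ λ d → vert d ≡ u × vert (α d) ≡ v × T d ≡ true

  HasRedOddCycle : EdgeColouring → Set
  HasRedOddCycle T =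
    Σ ℕ λ j → Σ (ℕ → Fin V) λ w →
      let k = suc (suc (suc (j + j))) in
      (∀ a b → a < k → b < k → w a ≡ w b → a ≡ b)
      × (∀ a → suc a < k → RedAdj T (w a) (w (suc a)))
      × RedAdj T (w (suc (suc (j + j)))) (w 0)

  FourColourable : Set
  FourColourable = Σ (Fin V → Fin 4) λ c → ∀ u v → Adj M u v → c u ≢ c v

{-# OPTIONS --safe #-}
module Submission where

open import Defs
open import Data.Product using (Σ; _×_; _,_; proj₁; proj₂)
open import Data.Sum using (_⊎_; inj₁; inj₂)
open import Relation.Nullary using (¬_)
open import Data.Nat using (ℕ; zero; suc; _+_; _≤_; _<_; s≤s)
open import Data.Nat.Properties using (+-suc; ≤-reflexive; <⇒≤)
open import Data.Fin using (Fin; zero; suc)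
open import Data.Bool using (Bool; true; false; not; _xor_)
open import Data.Bool.Properties using (not-involutive; ¬-not; not-¬; xor-comm)
open import Data.Unit using (tt)
open import Data.Empty using (⊥)
open import Function using (_∘_)
open import Relation.Binary.PropositionalEquality

-- The colours of a proper 4-colouring are paired as {0,1} and {2,3}; an edge is
-- red when its ends lie in the same pair.  Three distinct colours cannot all lie
-- in one pair and cannot be spread over three pairs, so every triangle gets
-- exactly one red edge.  Along a red edge the colour changes within its pair,
-- i.e. the parity of the colour flips, so every red cycle is even.

_≡ᵇ_ : Bool → Bool → Bool
a ≡ᵇ b = not (a xor b)

≡ᵇ-sym : ∀ a b → (a ≡ᵇ b) ≡ (b ≡ᵇ a)
≡ᵇ-sym a b = cong not (xor-comm a b)

≡ᵇ-true⇒≡ : ∀ {a b} → (a ≡ᵇ b) ≡ true → a ≡ b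
≡ᵇ-true⇒≡ {true}  {true}  _ = refl
≡ᵇ-true⇒≡ {false} {false} _ = refl

no-three-distinct-bools : ∀ {a b c : Bool} → a ≢ b → b ≢ c → c ≢ a → ⊥
no-three-distinct-bools a≢b b≢c c≢a =
  c≢a (trans (¬-not (b≢c ∘ sym)) (sym (¬-not a≢b)))

ExactlyOneTrue-cong : ∀ {a a′ b b′ c c′} → a ≡ a′ → b ≡ b′ → c ≡ c′ →
                      ExactlyOneTrue a b c → ExactlyOneTrue a′ b′ c′
ExactlyOneTrue-cong refl refl refl t = t

exactlyOne-agreement : ∀ a b c → ¬ (a ≡ b × b ≡ c) →
                       ExactlyOneTrue (a ≡ᵇ b) (b ≡ᵇ c) (c ≡ᵇ a)
exactlyOne-agreement true  true  true  ¬allEq = ¬allEq (refl , refl)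
exactlyOne-agreement true  true  false _      = tt
exactlyOne-agreement true  false true  _      = tt
exactlyOne-agreement true  false false _      = tt
exactlyOne-agreement false true  true  _      = tt
exactlyOne-agreement false true  false _      = tt
exactlyOne-agreement false false true  _      = tt
exactlyOne-agreement false false false ¬allEq = ¬allEq (refl , refl)

alternating⇒even-steps-agree : ∀ {f : ℕ → Bool} {n} →
  (∀ a → a < n → f (suc a) ≡ not (f a)) → ∀ i → i + i ≤ n → f (i + i) ≡ f 0
alternating⇒even-steps-agree alt zero    _ = refl
alternating⇒even-steps-agree {f} {n} alt (suc i) 2i+2≤n =
  begin
    f (suc (i + suc i))    ≡⟨ cong (f ∘ suc) (+-suc i i) ⟩
    f (suc (suc (i + i)))  ≡⟨ alt _ 2i+2≤n′ ⟩
    not (f (suc (i + i)))  ≡⟨ cong not (alt _ (<⇒≤ 2i+2≤n′)) ⟩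
    not (not (f (i + i)))  ≡⟨ not-involutive _ ⟩
    f (i + i)              ≡⟨ alternating⇒even-steps-agree alt i (<⇒≤ (<⇒≤ 2i+2≤n′)) ⟩
    f 0                    ∎
  where
    open ≡-Reasoning
    2i+2≤n′ : suc (suc (i + i)) ≤ n
    2i+2≤n′ = subst (λ m → suc m ≤ n) (+-suc i i) 2i+2≤n

no-odd-closed-alternating-walk : ∀ {f : ℕ → Bool} j →
  (∀ a → a < suc (suc (j + j)) → f (suc a) ≡ not (f a)) →
  f 0 ≡ not (f (suc (suc (j + j)))) → ⊥
no-odd-closed-alternating-walk {f} j alt close = not-¬ refl (trans close (cong not f2j+2≡f0))
  where
    f2j+2≡f0 : f (suc (suc (j + j))) ≡ f 0
    f2j+2≡f0 = subst (λ m → f m ≡ f 0) (cong suc (+-suc j j))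
                     (alternating⇒even-steps-agree alt (suc j)
                        (≤-reflexive (cong suc (+-suc j j))))

pairOf : Fin 4 → Bool
pairOf zero                   = false
pairOf (suc zero)             = false
pairOf (suc (suc zero))       = true
pairOf (suc (suc (suc zero))) = true

parity : Fin 4 → Bool
parity zero                   = false
parity (suc zero)             = true
parity (suc (suc zero))       = false
parity (suc (suc (suc zero))) = true

colourOf : Bool → Bool → Fin 4
colourOf false false = zero
colourOf false true  = suc zero
colourOf true  false = suc (suc zero)
colourOf true  true  = suc (suc (suc zero))

colourOf-pairOf-parity : ∀ x → colourOf (pairOf x) (parity x) ≡ x
colourOf-pairOf-parity zero                   = refl
colourOf-pairOf-parity (suc zero)             = refl
colourOf-pairOf-parity (suc (suc zero))       = refl
colourOf-pairOf-parity (suc (suc (suc zero))) = refl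

pairOf-parity-injective : ∀ {x y} → pairOf x ≡ pairOf y → parity x ≡ parity y → x ≡ y
pairOf-parity-injective {x} {y} p q = begin
  x                             ≡⟨ sym (colourOf-pairOf-parity x) ⟩
  colourOf (pairOf x) (parity x) ≡⟨ cong₂ colourOf p q ⟩
  colourOf (pairOf y) (parity y) ≡⟨ colourOf-pairOf-parity y ⟩
  y                             ∎
  where open ≡-Reasoning

parity-flips-within-pair : ∀ {x y} → x ≢ y → pairOf x ≡ pairOf y → parity y ≡ not (parity x)
parity-flips-within-pair x≢y p = ¬-not (λ q → x≢y (pairOf-parity-injective p (sym q)))

distinct-colours-not-in-one-pair : ∀ {x y z} → x ≢ y → y ≢ z → z ≢ x →
  ¬ (pairOf x ≡ pairOf y × pairOf y ≡ pairOf z)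
distinct-colours-not-in-one-pair x≢y y≢z z≢x (p , q) =
  no-three-distinct-bools
    (λ r → x≢y (pairOf-parity-injective p r))
    (λ r → y≢z (pairOf-parity-injective q r))
    (λ r → z≢x (pairOf-parity-injective (sym (trans p q)) r))

module _ (M : PlaneGraph) where
  open PlaneGraph M

  vert-φ : ∀ d → vert (φ M d) ≡ vert (α d)
  vert-φ d = orbit-vert (α d) 1

  triangle-vertices-adjacent : ∀ {d} → TriangularAt M d →
    Adj M (vert d) (vert (φ M d)) × Adj M (vert (φ M d)) (vert (φ M (φ M d)))
      × Adj M (vert (φ M (φ M d))) (vert d)
  triangle-vertices-adjacent {d} (_ , φ³d≡d , _) =
      (d , refl , sym (vert-φ d))
    , (φ M d , refl , sym (vert-φ (φ M d)))
    , (φ M (φ M d) , refl , trans (sym (vert-φ (φ M (φ M d)))) (cong vert φ³d≡d))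

  inner-faces-triangular : (K : Kind M) → ∀ d → Inner K (face d) → TriangularAt M d
  inner-faces-triangular (mpg isMPG)        d _     = isMPG d
  inner-faces-triangular (semi _ _ _ isSemi) d inner = proj₂ (isSemi d) inner

  sameLabelColouring : (Fin V → Bool) → EdgeColouring M
  sameLabelColouring ℓ = (λ d → ℓ (vert d) ≡ᵇ ℓ (vert (α d))) , symmetric
    where
      symmetric : ∀ d → ℓ (vert (α d)) ≡ᵇ ℓ (vert (α (α d))) ≡ ℓ (vert d) ≡ᵇ ℓ (vert (α d))
      symmetric d = trans (cong (λ e → ℓ (vert (α d)) ≡ᵇ ℓ (vert e)) (α-inv d))
                          (≡ᵇ-sym (ℓ (vert (α d))) (ℓ (vert d)))

  sameLabel-triangle-exactlyOne : ∀ ℓ {d} → TriangularAt M d →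
    let a = ℓ (vert d) ; b = ℓ (vert (φ M d)) ; c = ℓ (vert (φ M (φ M d))) in
    ¬ (a ≡ b × b ≡ c) →
    ExactlyOneTrue (proj₁ (sameLabelColouring ℓ) d) (proj₁ (sameLabelColouring ℓ) (φ M d))
                   (proj₁ (sameLabelColouring ℓ) (φ M (φ M d)))
  sameLabel-triangle-exactlyOne ℓ {d} (_ , φ³d≡d , _) ¬allEq =
    ExactlyOneTrue-cong (around d) (around (φ M d)) closing (exactlyOne-agreement _ _ _ ¬allEq)
    where
      around : ∀ e → ℓ (vert e) ≡ᵇ ℓ (vert (φ M e)) ≡ ℓ (vert e) ≡ᵇ ℓ (vert (α e))
      around e = cong (λ v → ℓ (vert e) ≡ᵇ ℓ v) (vert-φ e)
      closing : ℓ (vert (φ M (φ M d))) ≡ᵇ ℓ (vert d) ≡ ℓ (vert (φ M (φ M d))) ≡ᵇ ℓ (vert (α (φ M (φ M d))))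
      closing = cong (λ v → ℓ (vert (φ M (φ M d))) ≡ᵇ ℓ v)
                     (trans (cong vert (sym φ³d≡d)) (vert-φ (φ M (φ M d))))

  red⇒adjacent-same-label : ∀ ℓ {u v} → RedAdj M (sameLabelColouring ℓ) u v → Adj M u v × ℓ u ≡ ℓ v
  red⇒adjacent-same-label ℓ (d , refl , refl , red) = (d , refl , refl) , ≡ᵇ-true⇒≡ red

pairColouring : (M : PlaneGraph) → (Fin (PlaneGraph.V M) → Fin 4) → EdgeColouring M
pairColouring M c = sameLabelColouring M (pairOf ∘ c)

module _ (M : PlaneGraph) (c : Fin (PlaneGraph.V M) → Fin 4)
         (proper : ∀ u v → Adj M u v → c u ≢ c v) where

  pairColouring-isRTiling : (K : Kind M) → IsRTiling M K (pairColouring M c)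
  pairColouring-isRTiling K d inner =
    let (ab , bc , ca) = triangle-vertices-adjacent M triangle in
    sameLabel-triangle-exactlyOne M (pairOf ∘ c) triangle
      (distinct-colours-not-in-one-pair (proper _ _ ab) (proper _ _ bc) (proper _ _ ca))
    where
      triangle : TriangularAt M d
      triangle = inner-faces-triangular M K d inner

  red-edge-flips-parity : ∀ {u v} → RedAdj M (pairColouring M c) u v → parity (c v) ≡ not (parity (c u))
  red-edge-flips-parity red with red⇒adjacent-same-label M (pairOf ∘ c) red
  ... | adj , samePair = parity-flips-within-pair (proper _ _ adj) samePair

  pairColouring-no-red-odd-cycle : ¬ HasRedOddCycle M (pairColouring M c)
  pairColouring-no-red-odd-cycle (j , w , _ , path , closing) =
    no-odd-closed-alternating-walk {parity ∘ c ∘ w} j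
      (λ a a<2j+2 → red-edge-flips-parity (path a (s≤s a<2j+2)))
      (red-edge-flips-parity closing)

corollary6p8 : (M : PlaneGraph) (K : Kind M)
    → (¬ (Σ (EdgeColouring M) λ T → IsRTiling M K T))
      ⊎ ((T : EdgeColouring M) → IsRTiling M K T → HasRedOddCycle M T)
    → ¬ FourColourable M
corollary6p8 M K (inj₁ noRTiling) (c , proper) =
  noRTiling (pairColouring M c , pairColouring-isRTiling M c proper K)
corollary6p8 M K (inj₂ allHaveOddCycle) (c , proper) =
  pairColouring-no-red-odd-cycle M c proper
    (allHaveOddCycle (pairColouring M c) (pairColouring-isRTiling M c proper K))
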